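{- Let $X$ be a super $X$-set parameter and let $\Phi$ be an $X$-compliant closure family. Then for every graph $G$, the family $B_{X,\Phi}(G)$ is union-closed: if $R_1,R_2\in B_{X,\Phi}(G)$ then $R_1\cup R_2\in B_{X,\Phi}(G)$.
   Context: Graphs are finite, simple, with nonempty vertex set. A super $X$-set parameter $X$ is specified by an isomorphism-invariant property of vertex subsets (the $X$-sets) such that every graph has an $X$-set and supersets of $X$-sets are $X$-sets. A closure operator on $V$ is a map $\varphi:\mathcal{P}(V)\to\mathcal{P}(V)$ with $A\subseteq\varphi(A)$, $A_1\subseteq A_2\Rightarrow\varphi(A_1)\subseteq\varphi(A_2)$, and $\varphi\circ\varphi=\varphi$. A closure family $\Phi=\{\varphi_G\}$ assigns a closure operator $\varphi_G$ on $V(G)$ to each graph $G$, compatibly with isomorphisms ($\psi(\varphi_G(A))=\varphi_H(\psi(A))$ for every isomorphism $\psi:V(G)\to V(H)$). $\Phi$ is $X$-compliant if for every $G$, $S$ is an $X$-set iff $\varphi_G(S)=V(G)$. Define $B_{X,\Phi}(G)=\{V(G)\setminus\varphi_G(A): A\subseteq V(G)\text{ is not an }X\text{ -set}\}$. -}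

module Defs where

open import Level using (0ℓ) renaming (suc to lsuc)
open import Data.Nat using (ℕ; _<_)
open import Data.Bool using (Bool)
open import Data.Fin using (Fin)
open import Data.Fin.Subset using (Subset; _⊆_; _∪_; ∁; ⊤)
open import Data.Vec using (tabulate; lookup)
open import Data.Product using (Σ; ∃; _×_)
open import Function.Bundles using (_↔_; Inverse; _⇔_)
open import Relation.Binary.PropositionalEquality using (_≡_)
open import Relation.Nullary using (¬_)

record Graph : Set where
  field
    order    : ℕ
    nonempty : 0 < order
    adj      : Fin order → Fin order → Bool
    sym      : ∀ u v → adj u v ≡ adj v u
    irrefl   : ∀ u → adj u u ≡ Data.Bool.false

open Graph public

V : Graph → Set
V G = Fin (order G)

VSet : Graph → Set
VSet G = Subset (order G)

record Iso (G H : Graph) : Set where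
  field
    bij      : V G ↔ V H
    preserve : ∀ u v → adj G u v ≡ adj H (Inverse.to bij u) (Inverse.to bij v)

open Iso public

image : ∀ {G H} → Iso G H → VSet G → VSet H
image ψ A = tabulate (λ j → lookup A (Inverse.from (bij ψ) j))

record SuperXSetParameter : Set₁ where
  field
    IsXSet    : (G : Graph) → VSet G → Set
    invariant : ∀ {G H} (ψ : Iso G H) (A : VSet G) → IsXSet G A ⇔ IsXSet H (image ψ A)
    exists    : ∀ G → ∃ λ (A : VSet G) → IsXSet G A
    upward    : ∀ G {A B : VSet G} → A ⊆ B → IsXSet G A → IsXSet G B

open SuperXSetParameter public

record ClosureFamily : Set where
  field
    φ          : (G : Graph) → VSet G → VSet G
    extensive  : ∀ G (A : VSet G) → A ⊆ φ G A
    monotone   : ∀ G {A₁ A₂ : VSet G} → A₁ ⊆ A₂ → φ G A₁ ⊆ φ G A₂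
    idempotent : ∀ G (A : VSet G) → φ G (φ G A) ≡ φ G A
    iso-compat : ∀ {G H} (ψ : Iso G H) (A : VSet G) → image ψ (φ G A) ≡ φ H (image ψ A)

open ClosureFamily public

Compliant : SuperXSetParameter → ClosureFamily → Set
Compliant X Φ = ∀ G (S : VSet G) → IsXSet X G S ⇔ (φ Φ G S ≡ ⊤)

InB : (X : SuperXSetParameter) (Φ : ClosureFamily) (G : Graph) → VSet G → Set
InB X Φ G R = Σ (VSet G) λ A → ¬ IsXSet X G A × (R ≡ ∁ (φ Φ G A))

-- The sets of B(G) are exactly the complements of the φ_G-closed non-X-sets: for a non-X-set A,
-- compliance makes φ_G(A) a non-X-set as well. Closed sets are stable under intersection, and a
-- subset of a non-X-set is a non-X-set, so φ_G(A₁) ∩ φ_G(A₂) is a closed non-X-set whose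
-- complement is R₁ ∪ R₂ by de Morgan.
module Submission where

open import Defs
open import Data.Fin.Subset using (_∈_; _⊆_; _∩_; _∪_; ∁; ⊤)
open import Data.Fin.Subset.Properties using (⊆-antisym; p∩q⊆p; p∩q⊆q; x∈p∩q⁺; ∪-∩-booleanAlgebra)
open import Algebra.Lattice.Properties.BooleanAlgebra using (deMorgan₁)
open import Data.Product using (_,_)
open import Function.Bundles using (Equivalence)
open import Relation.Binary.PropositionalEquality using (_≡_; cong; cong₂; subst; module ≡-Reasoning)
open import Relation.Nullary using (¬_)

module _ (Φ : ClosureFamily) (G : Graph) where

  φ-least : {A B : VSet G} → A ⊆ φ Φ G B → φ Φ G A ⊆ φ Φ G B
  φ-least {B = B} A⊆φB x∈φA = subst (_ ∈_) (idempotent Φ G B) (monotone Φ G A⊆φB x∈φA)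

  φ-∩-closed : (A₁ A₂ : VSet G) → φ Φ G (φ Φ G A₁ ∩ φ Φ G A₂) ≡ φ Φ G A₁ ∩ φ Φ G A₂
  φ-∩-closed A₁ A₂ = ⊆-antisym
    (λ x∈ → x∈p∩q⁺ (φ-least (p∩q⊆p _ _) x∈ , φ-least (p∩q⊆q _ _) x∈))
    (extensive Φ G _)

module _ (X : SuperXSetParameter) (G : Graph) where

  ¬XSet-⊆ : {A B : VSet G} → A ⊆ B → ¬ IsXSet X G B → ¬ IsXSet X G A
  ¬XSet-⊆ A⊆B B∉X A∈X = B∉X (upward X G A⊆B A∈X)

  ¬XSet-φ : (Φ : ClosureFamily) → Compliant X Φ →
            {A : VSet G} → ¬ IsXSet X G A → ¬ IsXSet X G (φ Φ G A)
  ¬XSet-φ Φ compliant {A} A∉X φA∈X = A∉X (Equivalence.from (compliant G A) φA-full)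
    where
    φA-full : φ Φ G A ≡ ⊤
    φA-full = subst (_≡ ⊤) (idempotent Φ G A) (Equivalence.to (compliant G (φ Φ G A)) φA∈X)

proposition4p16 : (X : SuperXSetParameter) (Φ : ClosureFamily) → Compliant X Φ →
    ∀ (G : Graph) (R₁ R₂ : VSet G) → InB X Φ G R₁ → InB X Φ G R₂ → InB X Φ G (R₁ ∪ R₂)
proposition4p16 X Φ compliant G R₁ R₂ (A₁ , A₁∉X , R₁≡) (A₂ , _ , R₂≡) = A , A∉X , R₁∪R₂≡
  where
  open ≡-Reasoning
  A : VSet G
  A = φ Φ G A₁ ∩ φ Φ G A₂

  A∉X : ¬ IsXSet X G A
  A∉X = ¬XSet-⊆ X G (p∩q⊆p _ _) (¬XSet-φ X G Φ compliant A₁∉X)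

  R₁∪R₂≡ : R₁ ∪ R₂ ≡ ∁ (φ Φ G A)
  R₁∪R₂≡ = begin
    R₁ ∪ R₂                         ≡⟨ cong₂ _∪_ R₁≡ R₂≡ ⟩
    ∁ (φ Φ G A₁) ∪ ∁ (φ Φ G A₂)     ≡⟨ deMorgan₁ (∪-∩-booleanAlgebra _) _ _ ⟨
    ∁ A                             ≡⟨ cong ∁ (φ-∩-closed Φ G A₁ A₂) ⟨
    ∁ (φ Φ G A)                     ∎
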